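{- Let $G$ be a connected graph of order $n\geq 4$ with maximum degree $\Delta$ and minimum degree $\delta$, such that $\overline{G}$ is connected, and let $k$ be an integer with $2\le k\le n$. Let $s_1=\max\{\Delta,\,n-\delta-1\}$ and $t_1=\min\{\delta,\,n-\Delta-1\}$. Then: (1) $$(n-1)^2\binom{n}{k}s_1^{k-1}\geq \operatorname{SGut}_k(G)+\operatorname{SGut}_k(\overline{G})\geq\begin{cases}(n-1)(k-1)\binom{n}{k}t_1^{k-1} & \text{if } \delta\geq 2,\ \Delta\leq n-3,\\ n(k-1)\binom{n-1}{k-1}\frac{\delta^{k}}{k}+k\binom{n}{k} & \text{if } \delta\geq 2,\ \Delta=n-2,\\ k\binom{n}{k}+n(k-1)\binom{n-1}{k-1}\frac{(n-\Delta-1)^{k}}{k} & \text{if } \delta=1,\ \Delta\leq n-3,\\ 2k\binom{n}{k} & \text{if } \delta=1,\ \Delta=n-2;\end{cases}$$ (2) $$n^2\binom{n-1}{k-1}^2\frac{\Delta^{k-1}(n-\delta-1)^{k-1}(n-1)^4}{4k^2}\geq \operatorname{SGut}_k(G)\cdot\operatorname{SGut}_k(\overline{G})\geq\begin{cases}n^2(k-1)^2\binom{n-1}{k-1}^2\frac{\delta^k(n-\Delta-1)^k}{k^2} & \text{if } \delta\geq 2,\ \Delta\leq n-3,\\ n(k-1)\binom{n}{k}\binom{n-1}{k-1}\delta^{k} & \text{if } \delta\geq 2,\ \Delta=n-2,\\ n(k-1)\binom{n}{k}\binom{n-1}{k-1}(n-\Delta-1)^{k} & \text{if } \delta=1,\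 \Delta\leq n-3,\\ k^2\binom{n}{k}^2 & \text{if } \delta=1,\ \Delta=n-2.\end{cases}$$
   Context: All graphs are finite, simple and undirected; $\overline{G}$ is the complement of $G$. For a connected graph $G$ and $S\subseteq V(G)$ with $|S|\ge 2$, the Steiner distance $d_G(S)$ is the minimum number of edges of a connected subgraph of $G$ whose vertex set contains $S$. $\deg_G(v)$ is the degree of $v$. The Steiner Gutman $k$-index is $\operatorname{SGut}_k(G)=\sum_{S\subseteq V(G),\,|S|=k}\left(\prod_{v\in S}\deg_G(v)\right)d_G(S)$. -}

module Defs where

open import Data.Bool using (Bool; true; false; not; _∧_; if_then_else_)
open import Data.Nat using (ℕ; zero; suc; _+_; _*_; _∸_; _≤_; _<_; _≡ᵇ_; _<ᵇ_)
open import Data.Fin using (Fin; toℕ)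
open import Data.Fin.Subset using (Subset; _∈_; _⊆_; ∣_∣)
open import Data.Vec using (Vec; []; _∷_; lookup)
open import Data.List using (List; []; _∷_; map; _++_; filter; allFin)
open import Data.Nat.ListAction using (sum; product)
open import Data.Product using (Σ; _×_; _,_; ∃)
open import Relation.Binary.PropositionalEquality using (_≡_; _≢_; refl; cong; cong₂; trans)
open import Data.Bool.Properties using (∧-zeroʳ)
open import Function using (_⟨_⟩_)
open import Relation.Nullary using (¬_)
open import Data.Nat.Properties using (_≟_)

⟦_⟧ : Bool → ℕ
⟦ true ⟧ = 1
⟦ false ⟧ = 0

record Graph (n : ℕ) : Set where
  field
    adj    : Fin n → Fin n → Bool
    sym    : ∀ i j → adj i j ≡ adj j i
    irrefl : ∀ i → adj i i ≡ false
open Graph public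

_==_ : ∀ {n} → Fin n → Fin n → Bool
i == j = toℕ i ≡ᵇ toℕ j

deg : ∀ {n} → Graph n → Fin n → ℕ
deg {n} G v = sum (map (λ j → ⟦ adj G v j ⟧) (allFin n))

data Walk {n : ℕ} (E : Fin n → Fin n → Bool) : Fin n → Fin n → Set where
  here : ∀ {u} → Walk E u u
  step : ∀ {u w v} → E u w ≡ true → Walk E w v → Walk E u v

Connected : ∀ {n} → Graph n → Set
Connected G = ∀ u v → Walk (adj G) u v

not-adj : ∀ {n} → Graph n → Fin n → Fin n → Bool
not-adj G i j = not (adj G i j) ∧ not (i == j)


≡ᵇ-sym : ∀ m n → (m ≡ᵇ n) ≡ (n ≡ᵇ m)
≡ᵇ-sym zero zero = refl
≡ᵇ-sym zero (suc n) = refl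
≡ᵇ-sym (suc m) zero = refl
≡ᵇ-sym (suc m) (suc n) = ≡ᵇ-sym m n

≡ᵇ-refl : ∀ m → (m ≡ᵇ m) ≡ true
≡ᵇ-refl zero = refl
≡ᵇ-refl (suc m) = ≡ᵇ-refl m

complement : ∀ {n} → Graph n → Graph n
complement G = record
  { adj = not-adj G
  ; sym = λ i j → cong₂ (λ a b → not a ∧ not b) (sym G i j) (≡ᵇ-sym (toℕ i) (toℕ j))
  ; irrefl = λ i → cong (λ b → not (adj G i i) ∧ not b) (≡ᵇ-refl (toℕ i)) ⟨ trans ⟩ ∧-zeroʳ (not (adj G i i))
  }

record Subgraph {n : ℕ} (G : Graph n) : Set where
  field
    vert      : Subset n
    edge      : Fin n → Fin n → Bool
    edge-sym  : ∀ i j → edge i j ≡ edge j i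
    edge-adj  : ∀ i j → edge i j ≡ true → adj G i j ≡ true
    edge-vert : ∀ i j → edge i j ≡ true → (i ∈ vert) × (j ∈ vert)
open Subgraph public

ConnectedSub : ∀ {n} {G : Graph n} → Subgraph G → Set
ConnectedSub H = ∀ u v → u ∈ vert H → v ∈ vert H → Walk (edge H) u v

-- Number of edges of a subgraph (unordered pairs {i,j}, counted once via i < j)
edgeCount : ∀ {n} {G : Graph n} → Subgraph G → ℕ
edgeCount {n} H =
  sum (map (λ i → sum (map (λ j → ⟦ (toℕ i <ᵇ toℕ j) ∧ edge H i j ⟧) (allFin n))) (allFin n))

-- d is the Steiner distance d_G(S): the minimum number of edges of a connected
-- subgraph of G whose vertex set contains S (attained, and a lower bound)
IsSteinerDist : ∀ {n} → Graph n → Subset n → ℕ → Set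
IsSteinerDist G S d =
  (Σ (Subgraph G) λ H → (S ⊆ vert H) × ConnectedSub H × (edgeCount H ≡ d))
  × (∀ (H : Subgraph G) → S ⊆ vert H → ConnectedSub H → d ≤ edgeCount H)

subsets : ∀ n → List (Subset n)
subsets zero = [] ∷ []
subsets (suc n) = map (true ∷_) (subsets n) ++ map (false ∷_) (subsets n)

kSubsets : ∀ n → ℕ → List (Subset n)
kSubsets n k = filter (λ S → ∣ S ∣ ≟ k) (subsets n)

prodDeg : ∀ {n} → Graph n → Subset n → ℕ
prodDeg {n} G S = product (map (λ v → if lookup S v then deg G v else 1) (allFin n))

SGut : ∀ {n} → Graph n → ℕ → (Subset n → ℕ) → ℕ
SGut {n} G k d = sum (map (λ S → prodDeg G S * d S) (kSubsets n k))

IsMaxDegree : ∀ {n} → Graph n → ℕ → Set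
IsMaxDegree G Δ = (∀ v → deg G v ≤ Δ) × ∃ λ v → deg G v ≡ Δ

IsMinDegree : ∀ {n} → Graph n → ℕ → Set
IsMinDegree G δ = (∀ v → δ ≤ deg G v) × ∃ λ v → deg G v ≡ δ

-- For a k-set S, a minimum connected subgraph containing S has at least k − 1 edges (a connected
-- graph has at least one edge fewer than vertices) and at most n − 1 (it is no larger than a spanning
-- tree); both facts come from Kruskal's algorithm. If every vertex of S is a leaf, a Steiner tree with
-- only k − 1 edges would have vertex set S and so join two leaves, impossible in a connected graph on
-- n ≥ 3 vertices; otherwise some degree is ≥ 2 and 2(k − 1) ≥ k. Hence k ≤ ∏deg · d(S). The degree
-- products are bounded by powers of δ and Δ in G and of n−1−Δ and n−1−δ in the complement, where
-- deg_G v + deg_Ḡ v = n − 1. Summing the per-set bounds over the C(n,k) sets, with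
-- k·C(n,k) = n·C(n−1,k−1), gives every inequality; for the product, the factor at the least element
-- v_S of each S is kept aside and 4XY ≤ (X+Y)² is applied to X = Σ_S deg_G(v_S), Y = Σ_S deg_Ḡ(v_S),
-- whose sum is C(n,k)(n−1).
module Submission where

open import Defs renaming (sym to adj-sym)
open import Data.Bool using (Bool; true; false; not; _∧_; _∨_; if_then_else_)
open import Data.Bool.Properties using (∧-comm; ∨-comm; ∧-zeroʳ; ∨-zeroʳ; ∧-identityʳ; T-≡)
import Data.Bool as Bool
open import Data.Empty using (⊥; ⊥-elim)
open import Data.Fin using (Fin; zero; suc; toℕ)
import Data.Fin as Fin
open import Data.Fin.Properties using (toℕ-injective; any?)
open import Data.Fin.Subset using (Subset; ∣_∣; _∈_; _⊆_; ⁅_⁆; ⊤; Nonempty)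
open import Data.Fin.Subset.Properties
  using (_∈?_; ∈⊤; nonempty?; Empty-unique; ∣⊥∣≡0; p⊆q⇒∣p∣≤∣q∣; p⊂q⇒∣p∣<∣q∣; x∈⁅x⁆; ∣⁅x⁆∣≡1)
open import Data.List using (List; []; _∷_; _++_; map; tabulate; allFin; cartesianProduct; length; filter)
open import Data.List.Membership.Propositional using () renaming (_∈_ to _∈ₗ_)
open import Data.List.Membership.Propositional.Properties using (∈-allFin; ∈-cartesianProduct⁺; ∈-filter⁻)
open import Data.List.Properties using (map-tabulate; filter-++; length-++)
open import Data.List.Relation.Unary.Any using (here; there)
open import Data.Nat
open import Data.Nat.Combinatorics using (_C_; nCk+nC[k+1]≡[n+1]C[k+1]; nC1≡n)
open import Data.Nat.ListAction using (sum; product)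
open import Data.Nat.Properties
open import Algebra.Properties.CommutativeSemigroup +-commutativeSemigroup using (interchange)
open import Algebra.Properties.CommutativeMonoid.Sum +-0-commutativeMonoid
  using (sum-syntax; sum-cong-≗; ∑-distrib-+; sum-remove; sum-replicate-zero)
open import Data.Nat.Tactic.RingSolver using (solve-∀)
open import Data.Product using (Σ; ∃; _×_; _,_; proj₁; proj₂)
open import Data.Sum using (_⊎_; inj₁; inj₂; [_,_]′)
open import Data.Vec using (_∷_; []; lookup; here; there)
open import Data.Vec.Properties using (lookup⇒[]=)
open import Function using (_∘_; id; Equivalence)
open import Relation.Binary.PropositionalEquality
  using (_≡_; _≢_; refl; sym; trans; cong; cong₂; subst; subst₂; module ≡-Reasoning)
open import Relation.Nullary using (yes; no; does; ¬?; contradiction)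
open import Relation.Nullary.Decidable using (_×-dec_)

==⇒≡ : ∀ {n} {i j : Fin n} → (i == j) ≡ true → i ≡ j
==⇒≡ {i = i} {j} e = toℕ-injective (≡ᵇ⇒≡ (toℕ i) (toℕ j) (Equivalence.from T-≡ e))

==-refl : ∀ {n} (i : Fin n) → (i == i) ≡ true
==-refl i = ≡ᵇ-refl (toℕ i)

≡⇒== : ∀ {n} {i j : Fin n} → i ≡ j → (i == j) ≡ true
≡⇒== {i = i} refl = ==-refl i

≢⇒==-false : ∀ {n} {i j : Fin n} → i ≢ j → (i == j) ≡ false
≢⇒==-false {i = i} {j} i≢j with i == j in e
... | true  = ⊥-elim (i≢j (==⇒≡ e))
... | false = refl

sum-map-allFin : ∀ {n} (f : Fin n → ℕ) → sum (map f (allFin n)) ≡ ∑[ i < n ] f i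
sum-map-allFin f = trans (cong sum (map-tabulate id f)) (sum-tabulate f)
  where
  sum-tabulate : ∀ {n} (f : Fin n → ℕ) → sum (tabulate f) ≡ ∑[ i < n ] f i
  sum-tabulate {zero}  f = refl
  sum-tabulate {suc n} f = cong (f zero +_) (sum-tabulate (f ∘ suc))

∑-const : ∀ n c → ∑[ i < n ] c ≡ n * c
∑-const zero    c = refl
∑-const (suc n) c = cong (c +_) (∑-const n c)

∑-mono-≤ : ∀ {n} {f g : Fin n → ℕ} → (∀ i → f i ≤ g i) → ∑[ i < n ] f i ≤ ∑[ i < n ] g i
∑-mono-≤ {zero}  f≤g = z≤n
∑-mono-≤ {suc n} f≤g = +-mono-≤ (f≤g zero) (∑-mono-≤ (f≤g ∘ suc))

∑-select : ∀ {n} (w : Fin n) (f : Fin n → ℕ) → ∑[ j < n ] (⟦ j == w ⟧ * f j) ≡ f w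
∑-select {suc n} zero    f = trans (cong₂ _+_ (+-identityʳ (f zero)) (sum-replicate-zero n)) (+-identityʳ (f zero))
∑-select {suc n} (suc w) f = ∑-select w (f ∘ suc)

∑-indicator : ∀ {n} (w : Fin n) → ∑[ j < n ] ⟦ j == w ⟧ ≡ 1
∑-indicator w = trans (sum-cong-≗ (λ j → sym (*-identityʳ ⟦ j == w ⟧))) (∑-select w (λ _ → 1))

term≤∑ : ∀ {n} (f : Fin n → ℕ) (i : Fin n) → f i ≤ ∑[ j < n ] f j
term≤∑ {suc n} f i = subst (f i ≤_) (sym (sum-remove {i = i} f)) (m≤m+n (f i) _)

deg≡∑ : ∀ {n} (G : Graph n) v → deg G v ≡ ∑[ j < n ] ⟦ adj G v j ⟧
deg≡∑ G v = sum-map-allFin (λ j → ⟦ adj G v j ⟧)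

deg+deg-complement : ∀ {n} (G : Graph n) v → deg G v + deg (complement G) v + 1 ≡ n
deg+deg-complement {n} G v = begin
  deg G v + deg (complement G) v + 1
    ≡⟨ cong₂ (λ x y → x + y + 1) (deg≡∑ G v) (deg≡∑ (complement G) v) ⟩
  ∑[ j < n ] ⟦ adj G v j ⟧ + ∑[ j < n ] ⟦ not-adj G v j ⟧ + 1
    ≡⟨ cong (∑[ j < n ] ⟦ adj G v j ⟧ + ∑[ j < n ] ⟦ not-adj G v j ⟧ +_) (∑-indicator v) ⟨
  ∑[ j < n ] ⟦ adj G v j ⟧ + ∑[ j < n ] ⟦ not-adj G v j ⟧ + ∑[ j < n ] ⟦ j == v ⟧
    ≡⟨ cong (_+ ∑[ j < n ] ⟦ j == v ⟧) (∑-distrib-+ (λ j → ⟦ adj G v j ⟧) (λ j → ⟦ not-adj G v j ⟧)) ⟨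
  ∑[ j < n ] (⟦ adj G v j ⟧ + ⟦ not-adj G v j ⟧) + ∑[ j < n ] ⟦ j == v ⟧
    ≡⟨ ∑-distrib-+ (λ j → ⟦ adj G v j ⟧ + ⟦ not-adj G v j ⟧) (λ j → ⟦ j == v ⟧) ⟨
  ∑[ j < n ] (⟦ adj G v j ⟧ + ⟦ not-adj G v j ⟧ + ⟦ j == v ⟧)
    ≡⟨ sum-cong-≗ exactly-one ⟩
  ∑[ j < n ] 1
    ≡⟨ trans (∑-const n 1) (*-identityʳ n) ⟩
  n ∎
  where
  open ≡-Reasoning
  exactly-one : ∀ j → ⟦ adj G v j ⟧ + ⟦ not-adj G v j ⟧ + ⟦ j == v ⟧ ≡ 1
  exactly-one j with j Fin.≟ v
  ... | yes refl rewrite irrefl G j | ==-refl j = refl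
  ... | no j≢v rewrite ≢⇒==-false j≢v | ≢⇒==-false (j≢v ∘ sym) with adj G v j
  ...   | true  = refl
  ...   | false = refl

adj⇒1≤deg : ∀ {n} (G : Graph n) {v u} → adj G v u ≡ true → 1 ≤ deg G v
adj⇒1≤deg G {v} {u} e = subst (1 ≤_) (sym (deg≡∑ G v))
  (subst (λ b → ⟦ b ⟧ ≤ ∑[ j < _ ] ⟦ adj G v j ⟧) e (term≤∑ (λ j → ⟦ adj G v j ⟧) u))

two-neighbours⇒2≤deg : ∀ {n} (G : Graph n) {v a b} → a ≢ b →
  adj G v a ≡ true → adj G v b ≡ true → 2 ≤ deg G v
two-neighbours⇒2≤deg {n} G {v} {a} {b} a≢b ea eb = begin
  2                                         ≡⟨ cong₂ _+_ (∑-indicator a) (∑-indicator b) ⟨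
  ∑[ j < n ] ⟦ j == a ⟧ + ∑[ j < n ] ⟦ j == b ⟧ ≡⟨ ∑-distrib-+ (λ j → ⟦ j == a ⟧) (λ j → ⟦ j == b ⟧) ⟨
  ∑[ j < n ] (⟦ j == a ⟧ + ⟦ j == b ⟧)       ≤⟨ ∑-mono-≤ at-most-adj ⟩
  ∑[ j < n ] ⟦ adj G v j ⟧                   ≡⟨ deg≡∑ G v ⟨
  deg G v                                   ∎
  where
  open ≤-Reasoning
  at-most-adj : ∀ j → ⟦ j == a ⟧ + ⟦ j == b ⟧ ≤ ⟦ adj G v j ⟧
  at-most-adj j with j Fin.≟ a | j Fin.≟ b
  ... | yes refl | yes refl = ⊥-elim (a≢b refl)
  ... | yes refl | no j≢b rewrite ==-refl j | ≢⇒==-false j≢b | ea = ≤-refl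
  ... | no j≢a | yes refl rewrite ==-refl j | ≢⇒==-false j≢a | eb = ≤-refl
  ... | no j≢a | no j≢b rewrite ≢⇒==-false j≢a | ≢⇒==-false j≢b = z≤n

deg≤1⇒unique-neighbour : ∀ {n} (G : Graph n) {v a b} → deg G v ≤ 1 →
  adj G v a ≡ true → adj G v b ≡ true → a ≡ b
deg≤1⇒unique-neighbour G {a = a} {b} deg≤1 ea eb with a Fin.≟ b
... | yes a≡b = a≡b
... | no  a≢b = ⊥-elim (<-irrefl refl (≤-trans (two-neighbours⇒2≤deg G a≢b ea eb) deg≤1))

connected⇒1≤deg : ∀ {m} (G : Graph (2 + m)) → Connected G → ∀ v → 1 ≤ deg G v
connected⇒1≤deg G conn zero with conn zero (suc zero)
... | step e _ = adj⇒1≤deg G e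
connected⇒1≤deg G conn (suc v) with conn (suc v) zero
... | step e _ = adj⇒1≤deg G e

∣p∣≡∑ : ∀ {n} (p : Subset n) → ∣ p ∣ ≡ ∑[ v < n ] ⟦ lookup p v ⟧
∣p∣≡∑ []          = refl
∣p∣≡∑ (true ∷ p)  = cong suc (∣p∣≡∑ p)
∣p∣≡∑ (false ∷ p) = ∣p∣≡∑ p

1≤∣p∣⇒Nonempty : ∀ {n} {p : Subset n} → 1 ≤ ∣ p ∣ → Nonempty p
1≤∣p∣⇒Nonempty {n} {p} 1≤∣p∣ with nonempty? p
... | yes ne = ne
... | no ¬ne = contradiction (subst (1 ≤_) (trans (cong ∣_∣ (Empty-unique ¬ne)) (∣⊥∣≡0 n)) 1≤∣p∣) λ ()

2≤∣p∣⇒∃≢ : ∀ {n} {p : Subset n} → 2 ≤ ∣ p ∣ → ∀ x → ∃ λ y → y ∈ p × y ≢ x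
2≤∣p∣⇒∃≢ {p = p} 2≤∣p∣ x with any? (λ y → y ∈? p ×-dec ¬? (y Fin.≟ x))
... | yes found = found
... | no ¬found = contradiction (≤-trans 2≤∣p∣ (subst (∣ p ∣ ≤_) (∣⁅x⁆∣≡1 x) (p⊆q⇒∣p∣≤∣q∣ p⊆⁅x⁆))) λ { (s≤s ()) }
  where
  p⊆⁅x⁆ : p ⊆ ⁅ x ⁆
  p⊆⁅x⁆ {y} y∈p with y Fin.≟ x
  ... | yes refl = x∈⁅x⁆ x
  ... | no y≢x   = ⊥-elim (¬found (y , y∈p , y≢x))

p⊆q∧∣q∣≤∣p∣⇒q⊆p : ∀ {n} {p q : Subset n} → p ⊆ q → ∣ q ∣ ≤ ∣ p ∣ → q ⊆ p
p⊆q∧∣q∣≤∣p∣⇒q⊆p {p = p} p⊆q ∣q∣≤∣p∣ {x} x∈q with x ∈? p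
... | yes x∈p = x∈p
... | no  x∉p = contradiction (p⊂q⇒∣p∣<∣q∣ (p⊆q , x , x∈q , x∉p)) (≤⇒≯ ∣q∣≤∣p∣)

walk-++ : ∀ {n} {E : Fin n → Fin n → Bool} {a b c} → Walk E a b → Walk E b c → Walk E a c
walk-++ here       q = q
walk-++ (step e p) q = step e (walk-++ p q)

walk-map : ∀ {n} {E F : Fin n → Fin n → Bool} → (∀ {i j} → E i j ≡ true → F i j ≡ true) →
  ∀ {a b} → Walk E a b → Walk F a b
walk-map E⊆F here       = here
walk-map E⊆F (step e p) = step (E⊆F e) (walk-map E⊆F p)

edges : ∀ {n} → (Fin n → Fin n → Bool) → ℕ
edges {n} E = ∑[ i < n ] ∑[ j < n ] ⟦ (toℕ i <ᵇ toℕ j) ∧ E i j ⟧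

edgeCount≡edges : ∀ {n} {G : Graph n} (H : Subgraph G) → edgeCount H ≡ edges (edge H)
edgeCount≡edges {n} H = trans (sum-map-allFin (λ i → sum (map (count i) (allFin n))))
                               (sum-cong-≗ (λ i → sum-map-allFin (count i)))
  where
  count : Fin n → Fin n → ℕ
  count i j = ⟦ (toℕ i <ᵇ toℕ j) ∧ edge H i j ⟧

edges-mono : ∀ {n} {E F : Fin n → Fin n → Bool} → (∀ i j → E i j ≡ true → F i j ≡ true) →
  edges E ≤ edges F
edges-mono {E = E} {F} E⊆F = ∑-mono-≤ (λ i → ∑-mono-≤ (λ j → pointwise (toℕ i <ᵇ toℕ j) (E⊆F i j)))
  where
  pointwise : ∀ l {e f} → (e ≡ true → f ≡ true) → ⟦ l ∧ e ⟧ ≤ ⟦ l ∧ f ⟧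
  pointwise false     _   = z≤n
  pointwise true {false} _ = z≤n
  pointwise true {true} e⇒f rewrite e⇒f refl = ≤-refl

edges-∨ : ∀ {n} (E F : Fin n → Fin n → Bool) → (∀ i j → E i j ≡ true → F i j ≡ false) →
  edges (λ i j → E i j ∨ F i j) ≡ edges E + edges F
edges-∨ {n} E F disjoint = begin
  ∑[ i < n ] ∑[ j < n ] ⟦ lt i j ∧ (E i j ∨ F i j) ⟧
    ≡⟨ sum-cong-≗ (λ i → sum-cong-≗ (λ j → pointwise (lt i j) (disjoint i j))) ⟩
  ∑[ i < n ] ∑[ j < n ] (⟦ lt i j ∧ E i j ⟧ + ⟦ lt i j ∧ F i j ⟧)
    ≡⟨ sum-cong-≗ (λ i → ∑-distrib-+ (λ j → ⟦ lt i j ∧ E i j ⟧) (λ j → ⟦ lt i j ∧ F i j ⟧)) ⟩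
  ∑[ i < n ] (∑[ j < n ] ⟦ lt i j ∧ E i j ⟧ + ∑[ j < n ] ⟦ lt i j ∧ F i j ⟧)
    ≡⟨ ∑-distrib-+ (λ i → ∑[ j < n ] ⟦ lt i j ∧ E i j ⟧) (λ i → ∑[ j < n ] ⟦ lt i j ∧ F i j ⟧) ⟩
  edges E + edges F ∎
  where
  open ≡-Reasoning
  lt : Fin n → Fin n → Bool
  lt i j = toℕ i <ᵇ toℕ j
  pointwise : ∀ l {e f} → (e ≡ true → f ≡ false) → ⟦ l ∧ (e ∨ f) ⟧ ≡ ⟦ l ∧ e ⟧ + ⟦ l ∧ f ⟧
  pointwise false         _   = refl
  pointwise true {true}  e⇒¬f rewrite e⇒¬f refl = refl
  pointwise true {false} _   = refl

edges-pair : ∀ {n} (x y : Fin n) → edges (λ i j → i == x ∧ j == y) ≡ ⟦ toℕ x <ᵇ toℕ y ⟧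
edges-pair {n} x y = begin
  ∑[ i < n ] ∑[ j < n ] ⟦ (toℕ i <ᵇ toℕ j) ∧ (i == x ∧ j == y) ⟧
    ≡⟨ sum-cong-≗ (λ i → sum-cong-≗ (pointwise i)) ⟩
  ∑[ i < n ] ∑[ j < n ] (⟦ j == y ⟧ * (⟦ i == x ⟧ * ⟦ toℕ x <ᵇ toℕ y ⟧))
    ≡⟨ sum-cong-≗ (λ i → ∑-select y (λ _ → ⟦ i == x ⟧ * ⟦ toℕ x <ᵇ toℕ y ⟧)) ⟩
  ∑[ i < n ] (⟦ i == x ⟧ * ⟦ toℕ x <ᵇ toℕ y ⟧)
    ≡⟨ ∑-select x (λ _ → ⟦ toℕ x <ᵇ toℕ y ⟧) ⟩
  ⟦ toℕ x <ᵇ toℕ y ⟧ ∎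
  where
  open ≡-Reasoning
  pointwise : ∀ i j → ⟦ (toℕ i <ᵇ toℕ j) ∧ (i == x ∧ j == y) ⟧ ≡ ⟦ j == y ⟧ * (⟦ i == x ⟧ * ⟦ toℕ x <ᵇ toℕ y ⟧)
  pointwise i j with i Fin.≟ x | j Fin.≟ y
  ... | yes refl | yes refl rewrite ==-refl i | ==-refl j | ∧-identityʳ (toℕ i <ᵇ toℕ j) =
    sym (trans (+-identityʳ _) (+-identityʳ _))
  ... | yes refl | no j≢y rewrite ==-refl i | ≢⇒==-false j≢y | ∧-zeroʳ (toℕ i <ᵇ toℕ j) = refl
  ... | no i≢x   | _ rewrite ≢⇒==-false i≢x | ∧-zeroʳ (toℕ i <ᵇ toℕ j) = sym (*-zeroʳ ⟦ j == y ⟧)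

edges-∅ : ∀ {n} → edges {n} (λ _ _ → false) ≡ 0
edges-∅ {n} = begin
  ∑[ i < n ] ∑[ j < n ] ⟦ (toℕ i <ᵇ toℕ j) ∧ false ⟧
    ≡⟨ sum-cong-≗ {n} (λ i → sum-cong-≗ {n} (λ j → cong ⟦_⟧ (∧-zeroʳ (toℕ i <ᵇ toℕ j)))) ⟩
  ∑[ i < n ] ∑[ j < n ] 0
    ≡⟨ sum-cong-≗ {n} (λ _ → sum-replicate-zero n) ⟩
  ∑[ i < n ] 0
    ≡⟨ sum-replicate-zero n ⟩
  0 ∎
  where open ≡-Reasoning

<ᵇ-total : ∀ {m n} → m ≢ n → ⟦ m <ᵇ n ⟧ + ⟦ n <ᵇ m ⟧ ≡ 1
<ᵇ-total {zero}  {zero}  m≢n = contradiction refl m≢n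
<ᵇ-total {zero}  {suc n} _   = refl
<ᵇ-total {suc m} {zero}  _   = refl
<ᵇ-total {suc m} {suc n} m≢n = <ᵇ-total (m≢n ∘ cong suc)

⟦b⟧+⟦not-b⟧≡1 : ∀ b → ⟦ b ⟧ + ⟦ not b ⟧ ≡ 1
⟦b⟧+⟦not-b⟧≡1 true  = refl
⟦b⟧+⟦not-b⟧≡1 false = refl

∨-true : ∀ {a b} → a ∨ b ≡ true → a ≡ true ⊎ b ≡ true
∨-true {true}  _ = inj₁ refl
∨-true {false} e = inj₂ e

∧-true : ∀ {a b} → a ∧ b ≡ true → a ≡ true × b ≡ true
∧-true {true} e = refl , e

link : ∀ {n} → Fin n → Fin n → Fin n → Fin n → Bool
link x y i j = (i == x ∧ j == y) ∨ (i == y ∧ j == x)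

link-sym : ∀ {n} (x y i j : Fin n) → link x y i j ≡ link x y j i
link-sym x y i j = trans (∨-comm (i == x ∧ j == y) (i == y ∧ j == x))
  (cong₂ _∨_ (∧-comm (i == y) (j == x)) (∧-comm (i == x) (j == y)))

link-xy : ∀ {n} (x y : Fin n) → link x y x y ≡ true
link-xy x y rewrite ==-refl x | ==-refl y = refl

link-cases : ∀ {n} (x y i j : Fin n) → link x y i j ≡ true → (i ≡ x × j ≡ y) ⊎ (i ≡ y × j ≡ x)
link-cases x y i j e with ∨-true e
... | inj₁ e₁ = let i==x , j==y = ∧-true e₁ in inj₁ (==⇒≡ i==x , ==⇒≡ j==y)
... | inj₂ e₂ = let i==y , j==x = ∧-true e₂ in inj₂ (==⇒≡ i==y , ==⇒≡ j==x)

edges-link : ∀ {n} {x y : Fin n} → x ≢ y → edges (link x y) ≡ 1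
edges-link {x = x} {y} x≢y = begin
  edges (link x y)                              ≡⟨ edges-∨ (λ i j → i == x ∧ j == y) (λ i j → i == y ∧ j == x) disjoint ⟩
  edges (λ i j → i == x ∧ j == y) + edges (λ i j → i == y ∧ j == x)
                                                ≡⟨ cong₂ _+_ (edges-pair x y) (edges-pair y x) ⟩
  ⟦ toℕ x <ᵇ toℕ y ⟧ + ⟦ toℕ y <ᵇ toℕ x ⟧       ≡⟨ <ᵇ-total (x≢y ∘ toℕ-injective) ⟩
  1                                             ∎
  where
  open ≡-Reasoning
  disjoint : ∀ i j → (i == x ∧ j == y) ≡ true → (i == y ∧ j == x) ≡ false
  disjoint i j e with i == x in e₁ | i == y in e₂
  ... | true  | true  = contradiction (trans (sym (==⇒≡ {i = i} e₁)) (==⇒≡ e₂)) x≢y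
  ... | true  | false = refl
  ... | false | _     = contradiction e λ ()

module Kruskal {n} (R : Fin n → Fin n → Bool) (R-sym : ∀ i j → R i j ≡ R j i) where

  roots : (Fin n → Fin n) → ℕ
  roots rep = ∑[ v < n ] ⟦ rep v == v ⟧

  -- F is a forest in R whose trees are the classes of rep, rooted at the fixed points of rep;
  -- edges+roots≡n is the count "every tree has one edge fewer than vertices".
  record Forest : Set where
    field
      rep      : Fin n → Fin n
      rep-idem : ∀ v → rep (rep v) ≡ rep v
      F        : Fin n → Fin n → Bool
      F-sym    : ∀ i j → F i j ≡ F j i
      F⊆R      : ∀ i j → F i j ≡ true → R i j ≡ true
      F-rep    : ∀ i j → F i j ≡ true → rep i ≡ rep j
      rep-walk : ∀ a b → rep a ≡ rep b → Walk F a b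
      edges+roots≡n : edges F + roots rep ≡ n

  open Forest

  empty : Forest
  empty = record
    { rep      = id
    ; rep-idem = λ _ → refl
    ; F        = λ _ _ → false
    ; F-sym    = λ _ _ → refl
    ; F⊆R      = λ _ _ ()
    ; F-rep    = λ _ _ ()
    ; rep-walk = λ { a .a refl → here }
    ; edges+roots≡n = cong₂ _+_ (edges-∅ {n}) roots-id
    }
    where
    roots-id : roots id ≡ n
    roots-id = begin
      ∑[ v < n ] ⟦ v == v ⟧ ≡⟨ sum-cong-≗ {n} (λ v → cong ⟦_⟧ (==-refl v)) ⟩
      ∑[ v < n ] 1         ≡⟨ ∑-const n 1 ⟩
      n * 1                ≡⟨ *-identityʳ n ⟩
      n                    ∎
      where open ≡-Reasoning

  module Merge (s : Forest) {x y : Fin n} (Rxy : R x y ≡ true) (rx≢ry : rep s x ≢ rep s y) where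

    private
      r : Fin n → Fin n
      r = rep s
      x≢y : x ≢ y
      x≢y refl = rx≢ry refl

    rep′ : Fin n → Fin n
    rep′ z = if r z == r y then r x else r z

    F′ : Fin n → Fin n → Bool
    F′ i j = F s i j ∨ link x y i j

    rep′-x : rep′ x ≡ r x
    rep′-x rewrite ≢⇒==-false rx≢ry = refl

    rep′-y : rep′ y ≡ r x
    rep′-y rewrite ==-refl (r y) = refl

    rep′-cong : ∀ {a b} → r a ≡ r b → rep′ a ≡ rep′ b
    rep′-cong h = cong (λ t → if t == r y then r x else t) h

    rep′-idem : ∀ z → rep′ (rep′ z) ≡ rep′ z
    rep′-idem z with r z == r y in e
    ... | true  rewrite rep-idem s x | ≢⇒==-false rx≢ry = refl
    ... | false rewrite rep-idem s z | e = refl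

    F′-link : ∀ {i j} → link x y i j ≡ true → F′ i j ≡ true
    F′-link {i} {j} e rewrite e = ∨-zeroʳ (F s i j)

    F⊆F′ : ∀ {i j} → F s i j ≡ true → F′ i j ≡ true
    F⊆F′ e = cong (_∨ _) e

    F′-sym : ∀ i j → F′ i j ≡ F′ j i
    F′-sym i j = cong₂ _∨_ (F-sym s i j) (link-sym x y i j)

    F′⊆R : ∀ i j → F′ i j ≡ true → R i j ≡ true
    F′⊆R i j e with ∨-true e
    ... | inj₁ Fij = F⊆R s i j Fij
    ... | inj₂ lij with link-cases x y i j lij
    ...   | inj₁ (refl , refl) = Rxy
    ...   | inj₂ (refl , refl) = trans (R-sym y x) Rxy

    F′-rep : ∀ i j → F′ i j ≡ true → rep′ i ≡ rep′ j
    F′-rep i j e with ∨-true e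
    ... | inj₁ Fij = rep′-cong (F-rep s i j Fij)
    ... | inj₂ lij with link-cases x y i j lij
    ...   | inj₁ (refl , refl) = trans rep′-x (sym rep′-y)
    ...   | inj₂ (refl , refl) = trans rep′-y (sym rep′-x)

    rep′-walk : ∀ a b → rep′ a ≡ rep′ b → Walk F′ a b
    rep′-walk a b h with r a == r y in ea | r b == r y in eb
    ... | true  | true  = walk-map F⊆F′ (rep-walk s a b (trans (==⇒≡ ea) (sym (==⇒≡ eb))))
    ... | true  | false = walk-++ (walk-map F⊆F′ (rep-walk s a y (==⇒≡ ea)))
                            (step (F′-link (trans (link-sym x y y x) (link-xy x y))) (walk-map F⊆F′ (rep-walk s x b h)))
    ... | false | true  = walk-++ (walk-map F⊆F′ (rep-walk s a x h))
                            (step (F′-link (link-xy x y)) (walk-map F⊆F′ (rep-walk s y b (sym (==⇒≡ eb)))))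
    ... | false | false = walk-map F⊆F′ (rep-walk s a b h)

    edges-F′ : edges F′ ≡ suc (edges (F s))
    edges-F′ = trans (edges-∨ (F s) (link x y) new-edge) (trans (cong (edges (F s) +_) (edges-link x≢y)) (+-comm _ 1))
      where
      new-edge : ∀ i j → F s i j ≡ true → link x y i j ≡ false
      new-edge i j Fij with link x y i j in lij
      ... | false = refl
      ... | true with link-cases x y i j lij | F-rep s i j Fij
      ...   | inj₁ (refl , refl) | rx≡ry = contradiction rx≡ry rx≢ry
      ...   | inj₂ (refl , refl) | ry≡rx = contradiction (sym ry≡rx) rx≢ry

    roots-rep′ : roots rep′ + 1 ≡ roots r
    roots-rep′ = begin
      roots rep′ + 1                                       ≡⟨ cong (roots rep′ +_) (∑-indicator (r y)) ⟨
      roots rep′ + ∑[ v < n ] ⟦ v == r y ⟧                 ≡⟨ ∑-distrib-+ (λ v → ⟦ rep′ v == v ⟧) (λ v → ⟦ v == r y ⟧) ⟨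
      ∑[ v < n ] (⟦ rep′ v == v ⟧ + ⟦ v == r y ⟧)           ≡⟨ sum-cong-≗ pointwise ⟩
      roots r                                              ∎
      where
      open ≡-Reasoning
      -- only the old root r y stops being a root
      pointwise : ∀ v → ⟦ rep′ v == v ⟧ + ⟦ v == r y ⟧ ≡ ⟦ r v == v ⟧
      pointwise v with v Fin.≟ r y
      ... | yes refl rewrite rep-idem s y | ==-refl (r y) | ≢⇒==-false rx≢ry = refl
      ... | no v≢ry rewrite ≢⇒==-false v≢ry | +-identityʳ ⟦ rep′ v == v ⟧ with r v == r y in e
      ...   | false = refl
      ...   | true rewrite ≢⇒==-false {i = r v} (λ rv≡v → v≢ry (trans (sym rv≡v) (==⇒≡ e)))
                         | ≢⇒==-false {i = r x} (λ rx≡v → rx≢ry (trans (sym (rep-idem s x))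
                                                                       (trans (cong r rx≡v) (==⇒≡ e)))) = refl

    merged : Forest
    merged = record
      { rep = rep′ ; rep-idem = rep′-idem ; F = F′ ; F-sym = F′-sym ; F⊆R = F′⊆R ; F-rep = F′-rep
      ; rep-walk = rep′-walk
      ; edges+roots≡n = begin
          edges F′ + roots rep′          ≡⟨ cong (_+ roots rep′) edges-F′ ⟩
          suc (edges (F s)) + roots rep′ ≡⟨ +-suc (edges (F s)) (roots rep′) ⟨
          edges (F s) + suc (roots rep′) ≡⟨ cong (edges (F s) +_) (trans (+-comm 1 (roots rep′)) roots-rep′) ⟩
          edges (F s) + roots r          ≡⟨ edges+roots≡n s ⟩
          n                              ∎
      }
      where open ≡-Reasoning

  consider : Forest → Fin n → Fin n → Forest
  consider s x y with R x y Bool.≟ true | rep s x Fin.≟ rep s y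
  ... | yes Rxy | no rx≢ry = Merge.merged s Rxy rx≢ry
  ... | yes _   | yes _    = s
  ... | no _    | _        = s

  consider-preserves : ∀ s x y {a b} → rep s a ≡ rep s b → rep (consider s x y) a ≡ rep (consider s x y) b
  consider-preserves s x y h with R x y Bool.≟ true | rep s x Fin.≟ rep s y
  ... | yes Rxy | no rx≢ry = Merge.rep′-cong s Rxy rx≢ry h
  ... | yes _   | yes _    = h
  ... | no _    | _        = h

  consider-joins : ∀ s {x y} → R x y ≡ true → rep (consider s x y) x ≡ rep (consider s x y) y
  consider-joins s {x} {y} Rxy with R x y Bool.≟ true | rep s x Fin.≟ rep s y
  ... | yes Rxy′ | no rx≢ry = trans (Merge.rep′-x s Rxy′ rx≢ry) (sym (Merge.rep′-y s Rxy′ rx≢ry))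
  ... | yes _    | yes rx≡ry = rx≡ry
  ... | no ¬Rxy  | _         = contradiction Rxy ¬Rxy

  run : Forest → List (Fin n × Fin n) → Forest
  run s []             = s
  run s ((x , y) ∷ ps) = run (consider s x y) ps

  run-preserves : ∀ s ps {a b} → rep s a ≡ rep s b → rep (run s ps) a ≡ rep (run s ps) b
  run-preserves s []             h = h
  run-preserves s ((x , y) ∷ ps) h = run-preserves (consider s x y) ps (consider-preserves s x y h)

  run-joins : ∀ s ps {x y} → (x , y) ∈ₗ ps → R x y ≡ true → rep (run s ps) x ≡ rep (run s ps) y
  run-joins s ((x , y) ∷ ps) (here refl) Rxy = run-preserves (consider s x y) ps (consider-joins s Rxy)
  run-joins s (_ ∷ ps)       (there xy∈) Rxy = run-joins _ ps xy∈ Rxy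

  kruskal : Σ Forest λ s → ∀ {a b} → Walk R a b → rep s a ≡ rep s b
  kruskal = final , walk⇒same-rep
    where
    final : Forest
    final = run empty (cartesianProduct (allFin n) (allFin n))
    walk⇒same-rep : ∀ {a b} → Walk R a b → rep final a ≡ rep final b
    walk⇒same-rep here            = refl
    walk⇒same-rep (step {u} {w} e p) = trans
      (run-joins empty _ (∈-cartesianProduct⁺ (∈-allFin u) (∈-allFin w)) e) (walk⇒same-rep p)

  non-roots≡edges : ∀ s → ∑[ v < n ] ⟦ not (rep s v == v) ⟧ ≡ edges (F s)
  non-roots≡edges s = +-cancelˡ-≡ (roots (rep s)) _ _ (begin
    roots (rep s) + ∑[ v < n ] ⟦ not (rep s v == v) ⟧
      ≡⟨ ∑-distrib-+ (λ v → ⟦ rep s v == v ⟧) (λ v → ⟦ not (rep s v == v) ⟧) ⟨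
    ∑[ v < n ] (⟦ rep s v == v ⟧ + ⟦ not (rep s v == v) ⟧)
      ≡⟨ sum-cong-≗ {n} (λ v → ⟦b⟧+⟦not-b⟧≡1 (rep s v == v)) ⟩
    ∑[ v < n ] 1
      ≡⟨ trans (∑-const n 1) (*-identityʳ n) ⟩
    n
      ≡⟨ trans (sym (edges+roots≡n s)) (+-comm (edges (F s)) (roots (rep s))) ⟩
    roots (rep s) + edges (F s) ∎)
    where open ≡-Reasoning

connected-subgraph-size : ∀ {n} {G : Graph n} (H : Subgraph G) → ConnectedSub H →
  ∀ {r} → r ∈ vert H → ∣ vert H ∣ ≤ suc (edgeCount H)
connected-subgraph-size {n} H conn {r} r∈H = begin
  ∣ vert H ∣
    ≡⟨ ∣p∣≡∑ (vert H) ⟩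
  ∑[ v < n ] ⟦ lookup (vert H) v ⟧
    ≤⟨ ∑-mono-≤ root-of-r-or-non-root ⟩
  ∑[ v < n ] (⟦ v == rep r ⟧ + ⟦ not (rep v == v) ⟧)
    ≡⟨ ∑-distrib-+ (λ v → ⟦ v == rep r ⟧) (λ v → ⟦ not (rep v == v) ⟧) ⟩
  ∑[ v < n ] ⟦ v == rep r ⟧ + ∑[ v < n ] ⟦ not (rep v == v) ⟧
    ≡⟨ cong₂ _+_ (∑-indicator (rep r)) (non-roots≡edges forest) ⟩
  suc (edges F)
    ≤⟨ s≤s (edges-mono F⊆R) ⟩
  suc (edges (edge H))
    ≡⟨ cong suc (edgeCount≡edges H) ⟨
  suc (edgeCount H) ∎
  where
  open ≤-Reasoning
  open Kruskal (edge H) (edge-sym H)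
  forest : Forest
  forest = proj₁ kruskal
  open Forest forest
  root-of-r : ∀ {v} → lookup (vert H) v ≡ true → (rep v == v) ≡ true → v ≡ rep r
  root-of-r {v} v∈H root = trans (sym (==⇒≡ root)) (proj₂ kruskal (conn v r (lookup⇒[]= v (vert H) v∈H) r∈H))
  root-of-r-or-non-root : ∀ v → ⟦ lookup (vert H) v ⟧ ≤ ⟦ v == rep r ⟧ + ⟦ not (rep v == v) ⟧
  root-of-r-or-non-root v with lookup (vert H) v in v∈H | rep v == v in root
  ... | false | _     = z≤n
  ... | true  | false = m≤n+m 1 _
  ... | true  | true  rewrite ≡⇒== (root-of-r v∈H root) = ≤-refl

spanning-connected-subgraph : ∀ {m} (G : Graph (suc m)) → Connected G →
  Σ (Subgraph G) λ H → (∀ v → v ∈ vert H) × ConnectedSub H × edgeCount H ≤ m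
spanning-connected-subgraph {m} G conn = H , (λ _ → ∈⊤) , connected , edges≤m
  where
  open Kruskal (adj G) (adj-sym G)
  forest : Forest
  forest = proj₁ kruskal
  open Forest forest
  H : Subgraph G
  H = record { vert = ⊤ ; edge = F ; edge-sym = F-sym ; edge-adj = F⊆R ; edge-vert = λ _ _ _ → ∈⊤ , ∈⊤ }
  connected : ConnectedSub H
  connected u v _ _ = rep-walk u v (proj₂ kruskal (conn u v))
  1≤roots : 1 ≤ roots rep
  1≤roots = subst (λ b → ⟦ b ⟧ ≤ roots rep) (trans (cong (_== rep zero) (rep-idem zero)) (==-refl (rep zero)))
                  (term≤∑ (λ v → ⟦ rep v == v ⟧) (rep zero))
  edges≤m : edgeCount H ≤ m
  edges≤m = ≤-pred (begin
    suc (edgeCount H)      ≡⟨ cong suc (edgeCount≡edges H) ⟩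
    suc (edges F)          ≡⟨ +-comm 1 (edges F) ⟩
    edges F + 1            ≤⟨ +-monoʳ-≤ (edges F) 1≤roots ⟩
    edges F + roots rep    ≡⟨ edges+roots≡n ⟩
    suc m                  ∎)
    where open ≤-Reasoning

steinerDist-≥ : ∀ {n} {G : Graph n} {S D j} → ∣ S ∣ ≡ suc j → IsSteinerDist G S D → j ≤ D
steinerDist-≥ {S = S} {D} {j} ∣S∣≡1+j ((H , S⊆H , connH , edges≡D) , _)
  with 1≤∣p∣⇒Nonempty {p = S} (subst (1 ≤_) (sym ∣S∣≡1+j) (s≤s z≤n))
... | r , r∈S = ≤-pred (begin
  suc j             ≡⟨ ∣S∣≡1+j ⟨
  ∣ S ∣             ≤⟨ p⊆q⇒∣p∣≤∣q∣ S⊆H ⟩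
  ∣ vert H ∣        ≤⟨ connected-subgraph-size H connH (S⊆H r∈S) ⟩
  suc (edgeCount H) ≡⟨ cong suc edges≡D ⟩
  suc D             ∎)
  where open ≤-Reasoning

steinerDist-≤ : ∀ {m} {G : Graph (suc m)} {S D} → Connected G → IsSteinerDist G S D → D ≤ m
steinerDist-≤ {G = G} conn (_ , minimal) with spanning-connected-subgraph G conn
... | H , spans , connH , edges≤m = ≤-trans (minimal H (λ {v} _ → spans v) connH) edges≤m

∏ₛ : ∀ {n} → Subset n → (Fin n → ℕ) → ℕ
∏ₛ []          h = 1
∏ₛ (true ∷ S)  h = h zero * ∏ₛ S (h ∘ suc)
∏ₛ (false ∷ S) h = ∏ₛ S (h ∘ suc)

prodDeg≡∏ₛ : ∀ {n} (G : Graph n) S → prodDeg G S ≡ ∏ₛ S (deg G)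
prodDeg≡∏ₛ {n} G S = trans (cong product (map-tabulate id (λ v → if lookup S v then deg G v else 1)))
                          (product-tabulate S (deg G))
  where
  product-tabulate : ∀ {n} (S : Subset n) h → product (tabulate (λ v → if lookup S v then h v else 1)) ≡ ∏ₛ S h
  product-tabulate []          h = refl
  product-tabulate (true ∷ S)  h = cong (h zero *_) (product-tabulate S (h ∘ suc))
  product-tabulate (false ∷ S) h = trans (*-identityˡ _) (product-tabulate S (h ∘ suc))

∏ₛ-≥ : ∀ {n} (S : Subset n) {h : Fin n → ℕ} {m} → (∀ v → m ≤ h v) → m ^ ∣ S ∣ ≤ ∏ₛ S h
∏ₛ-≥ []          m≤h = ≤-refl
∏ₛ-≥ (true ∷ S)  m≤h = *-mono-≤ (m≤h zero) (∏ₛ-≥ S (m≤h ∘ suc))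
∏ₛ-≥ (false ∷ S) m≤h = ∏ₛ-≥ S (m≤h ∘ suc)

∏ₛ-≤ : ∀ {n} (S : Subset n) {h : Fin n → ℕ} {M} → (∀ v → h v ≤ M) → ∏ₛ S h ≤ M ^ ∣ S ∣
∏ₛ-≤ []          h≤M = ≤-refl
∏ₛ-≤ (true ∷ S)  h≤M = *-mono-≤ (h≤M zero) (∏ₛ-≤ S (h≤M ∘ suc))
∏ₛ-≤ (false ∷ S) h≤M = ∏ₛ-≤ S (h≤M ∘ suc)

1≤∏ₛ : ∀ {n} (S : Subset n) {h : Fin n → ℕ} → (∀ v → 1 ≤ h v) → 1 ≤ ∏ₛ S h
1≤∏ₛ S 1≤h = subst (_≤ ∏ₛ S _) (^-zeroˡ ∣ S ∣) (∏ₛ-≥ S 1≤h)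

∏ₛ-factor : ∀ {n} {S : Subset n} {h : Fin n → ℕ} → (∀ v → 1 ≤ h v) → ∀ {v} → v ∈ S → h v ≤ ∏ₛ S h
∏ₛ-factor {S = true ∷ S} {h} 1≤h here = subst (_≤ h zero * ∏ₛ S (h ∘ suc)) (*-identityʳ (h zero))
  (*-monoʳ-≤ (h zero) (1≤∏ₛ S (1≤h ∘ suc)))
∏ₛ-factor {S = true ∷ S} {h} 1≤h {suc v} (there v∈S) = subst (_≤ h zero * ∏ₛ S (h ∘ suc)) (*-identityˡ (h (suc v)))
  (*-mono-≤ (1≤h zero) (∏ₛ-factor (1≤h ∘ suc) v∈S))
∏ₛ-factor {S = false ∷ S} 1≤h (there v∈S) = ∏ₛ-factor (1≤h ∘ suc) v∈S

third-vertex : ∀ {m} (u w : Fin (3 + m)) → ∃ λ z → z ≢ u × z ≢ w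
third-vertex (suc u)       (suc w)       = zero , (λ ()) , (λ ())
third-vertex zero          zero          = suc zero , (λ ()) , (λ ())
third-vertex zero          (suc zero)    = suc (suc zero) , (λ ()) , (λ ())
third-vertex zero          (suc (suc w)) = suc zero , (λ ()) , (λ ())
third-vertex (suc zero)    zero          = suc (suc zero) , (λ ()) , (λ ())
third-vertex (suc (suc u)) zero          = suc zero , (λ ()) , (λ ())

adjacent-leaves⇒disconnected : ∀ {m} (G : Graph (3 + m)) → Connected G →
  ∀ {u w} → adj G u w ≡ true → deg G u ≤ 1 → deg G w ≤ 1 → ⊥
adjacent-leaves⇒disconnected G conn {u} {w} uw deg-u deg-w with third-vertex u w
... | z , z≢u , z≢w = [ z≢u , z≢w ]′ (trapped (conn u z) (inj₁ refl))
  where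
  trapped : ∀ {a b} → Walk (adj G) a b → a ≡ u ⊎ a ≡ w → b ≡ u ⊎ b ≡ w
  trapped here       at          = at
  trapped (step e p) (inj₁ refl) = trapped p (inj₂ (deg≤1⇒unique-neighbour G deg-u e uw))
  trapped (step e p) (inj₂ refl) = trapped p (inj₁ (deg≤1⇒unique-neighbour G deg-w e (trans (adj-sym G w u) uw)))

leaves⇒k≤steinerDist : ∀ {m} (G : Graph (3 + m)) → Connected G → ∀ {S k D} →
  (∀ {v} → v ∈ S → deg G v ≤ 1) → ∣ S ∣ ≡ k → 2 ≤ k → IsSteinerDist G S D → k ≤ D
leaves⇒k≤steinerDist G conn {S} {D = D} leaf refl 2≤∣S∣ ((H , S⊆H , connH , edges≡D) , _) with ∣ S ∣ ≤? D
... | yes ∣S∣≤D = ∣S∣≤D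
... | no  ∣S∣≰D with 1≤∣p∣⇒Nonempty {p = S} (≤-trans (s≤s z≤n) 2≤∣S∣)
...   | u , u∈S with 2≤∣p∣⇒∃≢ 2≤∣S∣ u
...     | v , v∈S , v≢u with connH u v (S⊆H u∈S) (S⊆H v∈S)
...       | here = contradiction refl v≢u
...       | step {w = w} uw _ = ⊥-elim (adjacent-leaves⇒disconnected G conn (edge-adj H u w uw) (leaf u∈S)
                                  (leaf (p⊆q∧∣q∣≤∣p∣⇒q⊆p S⊆H ∣H∣≤∣S∣ (proj₂ (edge-vert H u w uw)))))
  where
  ∣H∣≤∣S∣ : ∣ vert H ∣ ≤ ∣ S ∣
  ∣H∣≤∣S∣ = begin
    ∣ vert H ∣        ≤⟨ connected-subgraph-size H connH (S⊆H u∈S) ⟩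
    suc (edgeCount H) ≡⟨ cong suc edges≡D ⟩
    suc D             ≤⟨ ≰⇒> ∣S∣≰D ⟩
    ∣ S ∣             ∎
    where open ≤-Reasoning

k≤2*steinerDist : ∀ {n} {G : Graph n} {S k D} → ∣ S ∣ ≡ k → 2 ≤ k → IsSteinerDist G S D → k ≤ 2 * D
k≤2*steinerDist {k = suc j} {D} ∣S∣≡k (s≤s 1≤j) sd = begin
  suc j  ≤⟨ +-monoˡ-≤ j 1≤j ⟩
  j + j  ≤⟨ +-mono-≤ j≤D j≤D ⟩
  D + D  ≡⟨ cong (D +_) (+-identityʳ D) ⟨
  2 * D  ∎
  where
  open ≤-Reasoning
  j≤D : j ≤ D
  j≤D = steinerDist-≥ ∣S∣≡k sd

k≤prodDeg*steinerDist : ∀ {m} (G : Graph (3 + m)) → Connected G → ∀ {S k D} →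
  ∣ S ∣ ≡ k → 2 ≤ k → IsSteinerDist G S D → k ≤ prodDeg G S * D
k≤prodDeg*steinerDist G conn {S} {k} {D} ∣S∣≡k 2≤k sd with 2 ≤? prodDeg G S
... | yes 2≤Π = ≤-trans (k≤2*steinerDist ∣S∣≡k 2≤k sd) (*-monoˡ-≤ D 2≤Π)
... | no  2≰Π = begin
  k               ≤⟨ leaves⇒k≤steinerDist G conn leaf ∣S∣≡k 2≤k sd ⟩
  D               ≡⟨ *-identityˡ D ⟨
  1 * D           ≤⟨ *-monoˡ-≤ D 1≤Π ⟩
  prodDeg G S * D ∎
  where
  open ≤-Reasoning
  1≤Π : 1 ≤ prodDeg G S
  1≤Π = subst (1 ≤_) (sym (prodDeg≡∏ₛ G S)) (1≤∏ₛ S (connected⇒1≤deg G conn))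
  leaf : ∀ {v} → v ∈ S → deg G v ≤ 1
  leaf {v} v∈S = ≤-pred (begin
    suc (deg G v)          ≤⟨ s≤s (∏ₛ-factor (connected⇒1≤deg G conn) v∈S) ⟩
    suc (∏ₛ S (deg G))     ≡⟨ cong suc (prodDeg≡∏ₛ G S) ⟨
    suc (prodDeg G S)      ≤⟨ ≰⇒> 2≰Π ⟩
    2                      ∎)

firstValue : ∀ {n} → Subset n → (Fin n → ℕ) → ℕ
firstValue []          h = 0
firstValue (true ∷ S)  h = h zero
firstValue (false ∷ S) h = firstValue S (h ∘ suc)

firstValue-at : ∀ {n} (S : Subset n) → 1 ≤ ∣ S ∣ → ∃ λ v → ∀ h → firstValue S h ≡ h v
firstValue-at (true ∷ S)  _    = zero , λ _ → refl
firstValue-at (false ∷ S) 1≤∣S∣ with firstValue-at S 1≤∣S∣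
... | v , at-v = suc v , λ h → at-v (h ∘ suc)

∏ₛ-≤-firstValue : ∀ {n} (S : Subset n) {h : Fin n → ℕ} {M j} → ∣ S ∣ ≡ suc j →
  (∀ v → h v ≤ M) → ∏ₛ S h ≤ firstValue S h * M ^ j
∏ₛ-≤-firstValue (true ∷ S)  {h} refl  h≤M = *-monoʳ-≤ (h zero) (∏ₛ-≤ S (h≤M ∘ suc))
∏ₛ-≤-firstValue (false ∷ S) ∣S∣≡1+j h≤M = ∏ₛ-≤-firstValue S ∣S∣≡1+j (h≤M ∘ suc)

∏ₛ-≥-firstValue : ∀ {n} (S : Subset n) {h : Fin n → ℕ} {m j} → ∣ S ∣ ≡ suc j →
  (∀ v → m ≤ h v) → firstValue S h * m ^ j ≤ ∏ₛ S h
∏ₛ-≥-firstValue (true ∷ S)  {h} refl  m≤h = *-monoʳ-≤ (h zero) (∏ₛ-≥ S (m≤h ∘ suc))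
∏ₛ-≥-firstValue (false ∷ S) ∣S∣≡1+j m≤h = ∏ₛ-≥-firstValue S ∣S∣≡1+j (m≤h ∘ suc)

module _ {A : Set} where

  sum-map-mono-≤ : ∀ {f g : A → ℕ} xs → (∀ {x} → x ∈ₗ xs → f x ≤ g x) → sum (map f xs) ≤ sum (map g xs)
  sum-map-mono-≤ []       f≤g = z≤n
  sum-map-mono-≤ (x ∷ xs) f≤g = +-mono-≤ (f≤g (here refl)) (sum-map-mono-≤ xs (f≤g ∘ there))

  sum-map-+ : ∀ (f g : A → ℕ) xs → sum (map (λ x → f x + g x) xs) ≡ sum (map f xs) + sum (map g xs)
  sum-map-+ f g []       = refl
  sum-map-+ f g (x ∷ xs) = trans (cong (f x + g x +_) (sum-map-+ f g xs)) (interchange (f x) (g x) _ _)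

  sum-map-*ˡ : ∀ c (f : A → ℕ) xs → sum (map (λ x → c * f x) xs) ≡ c * sum (map f xs)
  sum-map-*ˡ c f []       = sym (*-zeroʳ c)
  sum-map-*ˡ c f (x ∷ xs) = trans (cong (c * f x +_) (sum-map-*ˡ c f xs)) (sym (*-distribˡ-+ c (f x) _))

  sum-map-const : ∀ c (xs : List A) → sum (map (λ _ → c) xs) ≡ length xs * c
  sum-map-const c []       = refl
  sum-map-const c (x ∷ xs) = cong (c +_) (sum-map-const c xs)

#k-++ : ∀ {n} k (L M : List (Subset n)) → length (filter (λ S → ∣ S ∣ ≟ k) (L ++ M)) ≡
  length (filter (λ S → ∣ S ∣ ≟ k) L) + length (filter (λ S → ∣ S ∣ ≟ k) M)
#k-++ k L M = trans (cong length (filter-++ (λ S → ∣ S ∣ ≟ k) L M)) (length-++ (filter (λ S → ∣ S ∣ ≟ k) L))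

#k-false∷ : ∀ {n} k (L : List (Subset n)) →
  length (filter (λ S → ∣ S ∣ ≟ k) (map (false ∷_) L)) ≡ length (filter (λ S → ∣ S ∣ ≟ k) L)
#k-false∷ k []      = refl
#k-false∷ k (S ∷ L) with does (∣ S ∣ ≟ k)
... | true  = cong suc (#k-false∷ k L)
... | false = #k-false∷ k L

#0-true∷ : ∀ {n} (L : List (Subset n)) → length (filter (λ S → ∣ S ∣ ≟ 0) (map (true ∷_) L)) ≡ 0
#0-true∷ []      = refl
#0-true∷ (S ∷ L) = #0-true∷ L

#suc-true∷ : ∀ {n} k (L : List (Subset n)) →
  length (filter (λ S → ∣ S ∣ ≟ suc k) (map (true ∷_) L)) ≡ length (filter (λ S → ∣ S ∣ ≟ k) L)
#suc-true∷ k []      = refl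
#suc-true∷ k (S ∷ L) with does (∣ S ∣ ≟ k)
... | true  = cong suc (#suc-true∷ k L)
... | false = #suc-true∷ k L

length-kSubsets : ∀ n k → length (kSubsets n k) ≡ n C k
length-kSubsets zero    zero    = refl
length-kSubsets zero    (suc k) = refl
length-kSubsets (suc n) zero    = trans (#k-++ 0 (map (true ∷_) (subsets n)) (map (false ∷_) (subsets n)))
  (cong₂ _+_ (#0-true∷ (subsets n)) (trans (#k-false∷ 0 (subsets n)) (length-kSubsets n 0)))
length-kSubsets (suc n) (suc k) = begin
  length (kSubsets (suc n) (suc k))
    ≡⟨ #k-++ (suc k) (map (true ∷_) (subsets n)) (map (false ∷_) (subsets n)) ⟩
  length (filter (λ S → ∣ S ∣ ≟ suc k) (map (true ∷_) (subsets n))) +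
  length (filter (λ S → ∣ S ∣ ≟ suc k) (map (false ∷_) (subsets n)))
    ≡⟨ cong₂ _+_ (trans (#suc-true∷ k (subsets n)) (length-kSubsets n k))
                 (trans (#k-false∷ (suc k) (subsets n)) (length-kSubsets n (suc k))) ⟩
  n C k + n C suc k
    ≡⟨ nCk+nC[k+1]≡[n+1]C[k+1] n k ⟩
  suc n C suc k ∎
  where open ≡-Reasoning

∑ₖ : ∀ n → ℕ → (Subset n → ℕ) → ℕ
∑ₖ n k f = sum (map f (kSubsets n k))

module _ {n k : ℕ} where

  ∑ₖ-mono-≤ : ∀ {f g : Subset n → ℕ} → (∀ S → ∣ S ∣ ≡ k → f S ≤ g S) → ∑ₖ n k f ≤ ∑ₖ n k g
  ∑ₖ-mono-≤ f≤g = sum-map-mono-≤ (kSubsets n k)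
    (λ {S} S∈ → f≤g S (proj₂ (∈-filter⁻ (λ S → ∣ S ∣ ≟ k) {xs = subsets n} S∈)))

  ∑ₖ-const : ∀ c → ∑ₖ n k (λ _ → c) ≡ (n C k) * c
  ∑ₖ-const c = trans (sum-map-const c (kSubsets n k)) (cong (_* c) (length-kSubsets n k))

  ∑ₖ-≥ : ∀ {f : Subset n → ℕ} c → (∀ S → ∣ S ∣ ≡ k → c ≤ f S) → (n C k) * c ≤ ∑ₖ n k f
  ∑ₖ-≥ {f} c c≤f = subst (_≤ ∑ₖ n k f) (∑ₖ-const c) (∑ₖ-mono-≤ c≤f)

  ∑ₖ-≤ : ∀ {f : Subset n → ℕ} c → (∀ S → ∣ S ∣ ≡ k → f S ≤ c) → ∑ₖ n k f ≤ (n C k) * c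
  ∑ₖ-≤ {f} c f≤c = subst (∑ₖ n k f ≤_) (∑ₖ-const c) (∑ₖ-mono-≤ f≤c)

  ∑ₖ-+ : ∀ (f g : Subset n → ℕ) → ∑ₖ n k (λ S → f S + g S) ≡ ∑ₖ n k f + ∑ₖ n k g
  ∑ₖ-+ f g = sum-map-+ f g (kSubsets n k)

  ∑ₖ-*ˡ : ∀ c (f : Subset n → ℕ) → ∑ₖ n k (λ S → c * f S) ≡ c * ∑ₖ n k f
  ∑ₖ-*ˡ c f = sum-map-*ˡ c f (kSubsets n k)

IsSteinerDists : ∀ {n} → Graph n → ℕ → (Subset n → ℕ) → Set
IsSteinerDists {n} G k d = ∀ (S : Subset n) → ∣ S ∣ ≡ k → IsSteinerDist G S (d S)

SGut-≥-minDeg : ∀ {n} (G : Graph n) {δ j d} → (∀ v → δ ≤ deg G v) → IsSteinerDists G (suc j) d →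
  (n C suc j) * (j * δ ^ suc j) ≤ SGut G (suc j) d
SGut-≥-minDeg G {δ} {j} {d} δ≤deg sd = ∑ₖ-≥ _ per-set
  where
  per-set : ∀ S → ∣ S ∣ ≡ suc j → j * δ ^ suc j ≤ prodDeg G S * d S
  per-set S ∣S∣≡k = subst (_≤ prodDeg G S * d S) (*-comm (δ ^ suc j) j) (*-mono-≤
    (subst₂ (λ i p → δ ^ i ≤ p) ∣S∣≡k (sym (prodDeg≡∏ₛ G S)) (∏ₛ-≥ S δ≤deg))
    (steinerDist-≥ ∣S∣≡k (sd S ∣S∣≡k)))

SGut-≥-k : ∀ {m} (G : Graph (3 + m)) → Connected G → ∀ {k d} → 2 ≤ k → IsSteinerDists G k d →
  ((3 + m) C k) * k ≤ SGut G k d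
SGut-≥-k G conn 2≤k sd = ∑ₖ-≥ _ (λ S ∣S∣≡k → k≤prodDeg*steinerDist G conn ∣S∣≡k 2≤k (sd S ∣S∣≡k))

prodDeg-≤ : ∀ {n} (G : Graph n) {S P j} → ∣ S ∣ ≡ suc j → (∀ v → deg G v ≤ P) →
  prodDeg G S ≤ firstValue S (deg G) * P ^ j
prodDeg-≤ G {S} ∣S∣≡1+j deg≤P =
  subst (_≤ firstValue S (deg G) * _) (sym (prodDeg≡∏ₛ G S)) (∏ₛ-≤-firstValue S ∣S∣≡1+j deg≤P)

prodDeg-≥ : ∀ {n} (G : Graph n) {S p j} → ∣ S ∣ ≡ suc j → (∀ v → p ≤ deg G v) →
  firstValue S (deg G) * p ^ j ≤ prodDeg G S
prodDeg-≥ G {S} ∣S∣≡1+j p≤deg =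
  subst (firstValue S (deg G) * _ ≤_) (sym (prodDeg≡∏ₛ G S)) (∏ₛ-≥-firstValue S ∣S∣≡1+j p≤deg)

4*[m*n]≤[m+n]*[m+n] : ∀ m n → 4 * (m * n) ≤ (m + n) * (m + n)
4*[m*n]≤[m+n]*[m+n] m n = [ ordered , (λ n≤m → subst₂ _≤_ (cong (4 *_) (*-comm n m)) (cong (λ x → x * x) (+-comm n m))
                                                            (ordered n≤m)) ]′ (≤-total m n)
  where
  square : ∀ m o → (m + (m + o)) * (m + (m + o)) ≡ 4 * (m * (m + o)) + o * o
  square = solve-∀
  ordered : ∀ {m n} → m ≤ n → 4 * (m * n) ≤ (m + n) * (m + n)
  ordered {m} m≤n with m≤n⇒∃[o]m+o≡n m≤n
  ... | o , refl = subst (4 * (m * (m + o)) ≤_) (sym (square m o)) (m≤m+n _ _)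

SGut-≤-∑firstValue : ∀ {m} (G : Graph (suc m)) → Connected G → ∀ {P j d} → (∀ v → deg G v ≤ P) →
  IsSteinerDists G (suc j) d → SGut G (suc j) d ≤ (P ^ j * m) * ∑ₖ (suc m) (suc j) (λ S → firstValue S (deg G))
SGut-≤-∑firstValue {m} G conn {P} {j} {d} deg≤P sd =
  subst (SGut G (suc j) d ≤_) (∑ₖ-*ˡ (P ^ j * m) (λ S → firstValue S (deg G))) (∑ₖ-mono-≤ per-set)
  where
  per-set : ∀ S → ∣ S ∣ ≡ suc j → prodDeg G S * d S ≤ (P ^ j * m) * firstValue S (deg G)
  per-set S ∣S∣≡k = begin
    prodDeg G S * d S                   ≤⟨ *-mono-≤ (prodDeg-≤ G {S} ∣S∣≡k deg≤P) (steinerDist-≤ conn (sd S ∣S∣≡k)) ⟩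
    firstValue S (deg G) * P ^ j * m    ≡⟨ rotate (firstValue S (deg G)) (P ^ j) m ⟩
    (P ^ j * m) * firstValue S (deg G)  ∎
    where
    open ≤-Reasoning
    rotate : ∀ x y z → x * y * z ≡ (y * z) * x
    rotate = solve-∀

module ComplementaryPair {m} (G : Graph (suc m)) (conn : Connected G) (connᶜ : Connected (complement G))
  {j d dᶜ} (sd : IsSteinerDists G (suc j) d) (sdᶜ : IsSteinerDists (complement G) (suc j) dᶜ) where

  private
    Gᶜ : Graph (suc m)
    Gᶜ = complement G
    k Cₖ : ℕ
    k = suc j
    Cₖ = suc m C k
    a b : Fin (suc m) → ℕ
    a = deg G
    b = deg Gᶜ

  deg+deg-complement≡m : ∀ v → a v + b v ≡ m
  deg+deg-complement≡m v = suc-injective (trans (+-comm 1 _) (deg+deg-complement G v))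

  firstValue-a+b : ∀ S → ∣ S ∣ ≡ k → firstValue S a + firstValue S b ≡ m
  firstValue-a+b S ∣S∣≡k with firstValue-at S (subst (1 ≤_) (sym ∣S∣≡k) (s≤s z≤n))
  ... | v , at-v = trans (cong₂ _+_ (at-v a) (at-v b)) (deg+deg-complement≡m v)

  SGut+SGut-≤ : ∀ {s} → (∀ v → a v ≤ s) → (∀ v → b v ≤ s) →
    SGut G k d + SGut Gᶜ k dᶜ ≤ Cₖ * (m * (m * s ^ j))
  SGut+SGut-≤ {s} a≤s b≤s = subst (_≤ Cₖ * (m * (m * s ^ j)))
    (∑ₖ-+ (λ S → prodDeg G S * d S) (λ S → prodDeg Gᶜ S * dᶜ S)) (∑ₖ-≤ _ per-set)
    where
    per-set : ∀ S → ∣ S ∣ ≡ k → prodDeg G S * d S + prodDeg Gᶜ S * dᶜ S ≤ m * (m * s ^ j)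
    per-set S ∣S∣≡k = begin
      prodDeg G S * d S + prodDeg Gᶜ S * dᶜ S
        ≤⟨ +-mono-≤ (*-monoʳ-≤ (prodDeg G S) (steinerDist-≤ conn (sd S ∣S∣≡k)))
                    (*-monoʳ-≤ (prodDeg Gᶜ S) (steinerDist-≤ connᶜ (sdᶜ S ∣S∣≡k))) ⟩
      prodDeg G S * m + prodDeg Gᶜ S * m
        ≡⟨ *-distribʳ-+ m (prodDeg G S) (prodDeg Gᶜ S) ⟨
      (prodDeg G S + prodDeg Gᶜ S) * m
        ≤⟨ *-monoˡ-≤ m (+-mono-≤ (prodDeg-≤ G {S} ∣S∣≡k a≤s) (prodDeg-≤ Gᶜ {S} ∣S∣≡k b≤s)) ⟩
      (firstValue S a * s ^ j + firstValue S b * s ^ j) * m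
        ≡⟨ cong (_* m) (trans (cong (_* s ^ j) (sym (firstValue-a+b S ∣S∣≡k))) (*-distribʳ-+ (s ^ j) (firstValue S a) _)) ⟨
      m * s ^ j * m
        ≡⟨ *-comm (m * s ^ j) m ⟩
      m * (m * s ^ j) ∎
      where open ≤-Reasoning

  SGut+SGut-≥ : ∀ {t} → (∀ v → t ≤ a v) → (∀ v → t ≤ b v) →
    Cₖ * (j * (m * t ^ j)) ≤ SGut G k d + SGut Gᶜ k dᶜ
  SGut+SGut-≥ {t} t≤a t≤b = subst (Cₖ * (j * (m * t ^ j)) ≤_)
    (∑ₖ-+ (λ S → prodDeg G S * d S) (λ S → prodDeg Gᶜ S * dᶜ S)) (∑ₖ-≥ _ per-set)
    where
    per-set : ∀ S → ∣ S ∣ ≡ k → j * (m * t ^ j) ≤ prodDeg G S * d S + prodDeg Gᶜ S * dᶜ S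
    per-set S ∣S∣≡k = begin
      j * (m * t ^ j)
        ≡⟨ cong (j *_) (trans (sym (*-distribʳ-+ (t ^ j) (firstValue S a) _)) (cong (_* t ^ j) (firstValue-a+b S ∣S∣≡k))) ⟨
      j * (firstValue S a * t ^ j + firstValue S b * t ^ j)
        ≤⟨ *-monoʳ-≤ j (+-mono-≤ (prodDeg-≥ G {S} ∣S∣≡k t≤a) (prodDeg-≥ Gᶜ {S} ∣S∣≡k t≤b)) ⟩
      j * (prodDeg G S + prodDeg Gᶜ S)
        ≡⟨ trans (*-distribˡ-+ j (prodDeg G S) _) (cong₂ _+_ (*-comm j (prodDeg G S)) (*-comm j (prodDeg Gᶜ S))) ⟩
      prodDeg G S * j + prodDeg Gᶜ S * j
        ≤⟨ +-mono-≤ (*-monoʳ-≤ (prodDeg G S) (steinerDist-≥ ∣S∣≡k (sd S ∣S∣≡k)))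
                    (*-monoʳ-≤ (prodDeg Gᶜ S) (steinerDist-≥ ∣S∣≡k (sdᶜ S ∣S∣≡k))) ⟩
      prodDeg G S * d S + prodDeg Gᶜ S * dᶜ S ∎
      where open ≤-Reasoning

  SGut*SGut-≤ : ∀ {P Q} → (∀ v → a v ≤ P) → (∀ v → b v ≤ Q) →
    4 * (SGut G k d * SGut Gᶜ k dᶜ) ≤ (P ^ j * m) * (Q ^ j * m) * ((Cₖ * m) * (Cₖ * m))
  SGut*SGut-≤ {P} {Q} a≤P b≤Q = begin
    4 * (SGut G k d * SGut Gᶜ k dᶜ)
      ≤⟨ *-monoʳ-≤ 4 (*-mono-≤ (SGut-≤-∑firstValue G conn a≤P sd) (SGut-≤-∑firstValue Gᶜ connᶜ b≤Q sdᶜ)) ⟩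
    4 * ((P ^ j * m) * X * ((Q ^ j * m) * Y))
      ≡⟨ regroup (P ^ j * m) (Q ^ j * m) X Y ⟩
    (P ^ j * m) * (Q ^ j * m) * (4 * (X * Y))
      ≤⟨ *-monoʳ-≤ ((P ^ j * m) * (Q ^ j * m)) (≤-trans (4*[m*n]≤[m+n]*[m+n] X Y) (*-mono-≤ X+Y≤Cₖm X+Y≤Cₖm)) ⟩
    (P ^ j * m) * (Q ^ j * m) * ((Cₖ * m) * (Cₖ * m)) ∎
    where
    open ≤-Reasoning
    X Y : ℕ
    X = ∑ₖ (suc m) k (λ S → firstValue S a)
    Y = ∑ₖ (suc m) k (λ S → firstValue S b)
    X+Y≤Cₖm : X + Y ≤ Cₖ * m
    X+Y≤Cₖm = subst (_≤ Cₖ * m) (∑ₖ-+ (λ S → firstValue S a) (λ S → firstValue S b))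
                    (∑ₖ-≤ m (λ S ∣S∣≡k → ≤-reflexive (firstValue-a+b S ∣S∣≡k)))
    regroup : ∀ p q x y → 4 * ((p * x) * (q * y)) ≡ p * q * (4 * (x * y))
    regroup = solve-∀

[k+1]*[n+1]C[k+1]≡[n+1]*nCk : ∀ n k → suc k * (suc n C suc k) ≡ suc n * (n C k)
[k+1]*[n+1]C[k+1]≡[n+1]*nCk zero    zero    = refl
[k+1]*[n+1]C[k+1]≡[n+1]*nCk zero    (suc k) = *-zeroʳ (2 + k)
[k+1]*[n+1]C[k+1]≡[n+1]*nCk (suc n) zero    =
  trans (+-identityʳ _) (trans (nC1≡n (2 + n)) (sym (*-identityʳ (2 + n))))
[k+1]*[n+1]C[k+1]≡[n+1]*nCk (suc n) (suc k) = begin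
  (2 + k) * (suc (suc n) C suc (suc k)) ≡⟨ cong ((2 + k) *_) (nCk+nC[k+1]≡[n+1]C[k+1] (suc n) (suc k)) ⟨
  (2 + k) * (a + b)                   ≡⟨ *-distribˡ-+ (2 + k) a b ⟩
  (a + (1 + k) * a) + (2 + k) * b     ≡⟨ cong₂ (λ u w → (a + u) + w) ([k+1]*[n+1]C[k+1]≡[n+1]*nCk n k)
                                                                    ([k+1]*[n+1]C[k+1]≡[n+1]*nCk n (suc k)) ⟩
  (a + (1 + n) * x) + (1 + n) * y     ≡⟨ +-assoc a _ _ ⟩
  a + ((1 + n) * x + (1 + n) * y)     ≡⟨ cong (a +_) (*-distribˡ-+ (1 + n) x y) ⟨
  a + (1 + n) * (x + y)               ≡⟨ cong (λ u → a + (1 + n) * u) (nCk+nC[k+1]≡[n+1]C[k+1] n k) ⟩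
  (2 + n) * a                         ∎
  where
  open ≡-Reasoning
  a b x y : ℕ
  a = suc n C suc k
  b = suc n C suc (suc k)
  x = n C k
  y = n C suc k

[1+m]∸n∸1≡m∸n : ∀ m n → suc m ∸ n ∸ 1 ≡ m ∸ n
[1+m]∸n∸1≡m∸n m n = trans (∸-+-assoc (suc m) n 1) (cong (suc m ∸_) (+-comm n 1))

module Corollary {m} (G : Graph (3 + m)) {Δ δ j d dᶜ}
  (conn : Connected G) (connᶜ : Connected (complement G))
  (maxd : IsMaxDegree G Δ) (mind : IsMinDegree G δ) (2≤k : 2 ≤ suc j)
  (sd : IsSteinerDists G (suc j) d) (sdᶜ : IsSteinerDists (complement G) (suc j) dᶜ) where

  open ComplementaryPair G conn connᶜ sd sdᶜ

  private
    n M k Cₖ C′ A B e c : ℕ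
    n = 3 + m
    M = 2 + m
    k = suc j
    Cₖ = n C k
    C′ = M C j
    A = SGut G k d
    B = SGut (complement G) k dᶜ
    e = n ∸ δ ∸ 1
    c = n ∸ Δ ∸ 1

  n*C′≡Cₖ*k : n * C′ ≡ Cₖ * k
  n*C′≡Cₖ*k = trans (sym ([k+1]*[n+1]C[k+1]≡[n+1]*nCk M j)) (*-comm k Cₖ)

  deg-complement≡ : ∀ v → deg (complement G) v ≡ M ∸ deg G v
  deg-complement≡ v = trans (sym (m+n∸m≡n (deg G v) _)) (cong (_∸ deg G v) (deg+deg-complement≡m v))

  c≤deg-complement : ∀ v → c ≤ deg (complement G) v
  c≤deg-complement v = subst₂ _≤_ (sym ([1+m]∸n∸1≡m∸n M Δ)) (sym (deg-complement≡ v)) (∸-monoʳ-≤ M (proj₁ maxd v))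

  deg-complement≤e : ∀ v → deg (complement G) v ≤ e
  deg-complement≤e v = subst₂ _≤_ (sym (deg-complement≡ v)) (sym ([1+m]∸n∸1≡m∸n M δ)) (∸-monoʳ-≤ M (proj₁ mind v))

  A≥δ : Cₖ * (j * δ ^ k) ≤ A
  A≥δ = SGut-≥-minDeg G (proj₁ mind) sd

  B≥c : Cₖ * (j * c ^ k) ≤ B
  B≥c = SGut-≥-minDeg (complement G) c≤deg-complement sdᶜ

  A≥k : Cₖ * k ≤ A
  A≥k = SGut-≥-k G conn 2≤k sd

  B≥k : Cₖ * k ≤ B
  B≥k = SGut-≥-k (complement G) connᶜ 2≤k sdᶜ

  A+B≤ : A + B ≤ (n ∸ 1) ^ 2 * Cₖ * (Δ ⊔ e) ^ (k ∸ 1)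
  A+B≤ = subst (A + B ≤_) (shape Cₖ M ((Δ ⊔ e) ^ j))
    (SGut+SGut-≤ (λ v → ≤-trans (proj₁ maxd v) (m≤m⊔n Δ e)) (λ v → ≤-trans (deg-complement≤e v) (m≤n⊔m Δ e)))
    where
    shape : ∀ C M s → C * (M * (M * s)) ≡ M * (M * 1) * C * s
    shape = solve-∀

  A+B≥t₁ : (n ∸ 1) * (k ∸ 1) * Cₖ * (δ ⊓ c) ^ (k ∸ 1) ≤ A + B
  A+B≥t₁ = subst (_≤ A + B) (shape Cₖ j M ((δ ⊓ c) ^ j))
    (SGut+SGut-≥ (λ v → ≤-trans (m⊓n≤m δ c) (proj₁ mind v)) (λ v → ≤-trans (m⊓n≤n δ c) (c≤deg-complement v)))
    where
    shape : ∀ C j M t → C * (j * (M * t)) ≡ M * j * C * t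
    shape = solve-∀

  absorb : ∀ x → n * (k ∸ 1) * C′ * x ≡ (Cₖ * k) * (j * x)
  absorb x = trans (shape n j C′ x) (cong (_* (j * x)) n*C′≡Cₖ*k)
    where
    shape : ∀ n j C′ x → n * j * C′ * x ≡ (n * C′) * (j * x)
    shape = solve-∀

  A+B≥δ : n * (k ∸ 1) * C′ * δ ^ k + k * (k * Cₖ) ≤ k * (A + B)
  A+B≥δ = begin
    n * j * C′ * δ ^ k + k * (k * Cₖ)      ≡⟨ cong₂ _+_ (absorb (δ ^ k)) (cong (k *_) (*-comm k Cₖ)) ⟩
    (Cₖ * k) * (j * δ ^ k) + k * (Cₖ * k)  ≡⟨ shape Cₖ k (j * δ ^ k) ⟩
    k * (Cₖ * (j * δ ^ k) + Cₖ * k)        ≤⟨ *-monoʳ-≤ k (+-mono-≤ A≥δ B≥k) ⟩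
    k * (A + B)                            ∎
    where
    open ≤-Reasoning
    shape : ∀ C k y → (C * k) * y + k * (C * k) ≡ k * (C * y + C * k)
    shape = solve-∀

  A+B≥c : k * (k * Cₖ) + n * (k ∸ 1) * C′ * c ^ k ≤ k * (A + B)
  A+B≥c = begin
    k * (k * Cₖ) + n * j * C′ * c ^ k      ≡⟨ cong₂ _+_ (cong (k *_) (*-comm k Cₖ)) (absorb (c ^ k)) ⟩
    k * (Cₖ * k) + (Cₖ * k) * (j * c ^ k)  ≡⟨ shape Cₖ k (j * c ^ k) ⟩
    k * (Cₖ * k + Cₖ * (j * c ^ k))        ≤⟨ *-monoʳ-≤ k (+-mono-≤ A≥k B≥c) ⟩
    k * (A + B)                            ∎
    where
    open ≤-Reasoning
    shape : ∀ C k y → k * (C * k) + (C * k) * y ≡ k * (C * k + C * y)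
    shape = solve-∀

  A+B≥2k : 2 * k * Cₖ ≤ A + B
  A+B≥2k = subst (_≤ A + B) (shape k Cₖ) (+-mono-≤ A≥k B≥k)
    where
    shape : ∀ k C → C * k + C * k ≡ 2 * k * C
    shape = solve-∀

  A*B≤ : 4 * k ^ 2 * (A * B) ≤ n ^ 2 * C′ ^ 2 * (Δ ^ (k ∸ 1) * e ^ (k ∸ 1) * (n ∸ 1) ^ 4)
  A*B≤ = begin
    4 * k ^ 2 * (A * B)
      ≡⟨ shape₁ k (A * B) ⟩
    k ^ 2 * (4 * (A * B))
      ≤⟨ *-monoʳ-≤ (k ^ 2) (SGut*SGut-≤ (proj₁ maxd) deg-complement≤e) ⟩
    k ^ 2 * ((Δ ^ j * M) * (e ^ j * M) * ((Cₖ * M) * (Cₖ * M)))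
      ≡⟨ shape₂ k Cₖ (Δ ^ j) (e ^ j) M ⟩
    (Cₖ * k) * (Cₖ * k) * (Δ ^ j * e ^ j * M ^ 4)
      ≡⟨ cong (λ x → x * x * (Δ ^ j * e ^ j * M ^ 4)) n*C′≡Cₖ*k ⟨
    (n * C′) * (n * C′) * (Δ ^ j * e ^ j * M ^ 4)
      ≡⟨ shape₃ n C′ (Δ ^ j * e ^ j * M ^ 4) ⟩
    n ^ 2 * C′ ^ 2 * (Δ ^ j * e ^ j * M ^ 4) ∎
    where
    open ≤-Reasoning
    shape₁ : ∀ k x → 4 * (k * (k * 1)) * x ≡ k * (k * 1) * (4 * x)
    shape₁ = solve-∀
    shape₂ : ∀ k C P Q M → k * (k * 1) * ((P * M) * (Q * M) * ((C * M) * (C * M))) ≡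
                          (C * k) * (C * k) * (P * Q * (M * (M * (M * (M * 1)))))
    shape₂ = solve-∀
    shape₃ : ∀ n C x → (n * C) * (n * C) * x ≡ n * (n * 1) * (C * (C * 1)) * x
    shape₃ = solve-∀

  A*B≥δc : n ^ 2 * (k ∸ 1) ^ 2 * C′ ^ 2 * (δ ^ k * c ^ k) ≤ k ^ 2 * (A * B)
  A*B≥δc = begin
    n ^ 2 * j ^ 2 * C′ ^ 2 * (δ ^ k * c ^ k)                 ≡⟨ shape₁ n j C′ (δ ^ k) (c ^ k) ⟩
    (n * C′) * (n * C′) * (j * δ ^ k * (j * c ^ k))          ≡⟨ cong (λ x → x * x * (j * δ ^ k * (j * c ^ k))) n*C′≡Cₖ*k ⟩
    (Cₖ * k) * (Cₖ * k) * (j * δ ^ k * (j * c ^ k))          ≡⟨ shape₂ k Cₖ (j * δ ^ k) (j * c ^ k) ⟩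
    k ^ 2 * ((Cₖ * (j * δ ^ k)) * (Cₖ * (j * c ^ k)))        ≤⟨ *-monoʳ-≤ (k ^ 2) (*-mono-≤ A≥δ B≥c) ⟩
    k ^ 2 * (A * B)                                          ∎
    where
    open ≤-Reasoning
    shape₁ : ∀ n j C x y → n * (n * 1) * (j * (j * 1)) * (C * (C * 1)) * (x * y) ≡ (n * C) * (n * C) * (j * x * (j * y))
    shape₁ = solve-∀
    shape₂ : ∀ k C x y → (C * k) * (C * k) * (x * y) ≡ k * (k * 1) * ((C * x) * (C * y))
    shape₂ = solve-∀

  A*B≥δ : n * (k ∸ 1) * Cₖ * C′ * δ ^ k ≤ A * B
  A*B≥δ = begin
    n * j * Cₖ * C′ * δ ^ k         ≡⟨ shape n j Cₖ C′ (δ ^ k) ⟩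
    (Cₖ * (j * δ ^ k)) * (n * C′)   ≡⟨ cong (Cₖ * (j * δ ^ k) *_) n*C′≡Cₖ*k ⟩
    (Cₖ * (j * δ ^ k)) * (Cₖ * k)   ≤⟨ *-mono-≤ A≥δ B≥k ⟩
    A * B                           ∎
    where
    open ≤-Reasoning
    shape : ∀ n j C C′ x → n * j * C * C′ * x ≡ (C * (j * x)) * (n * C′)
    shape = solve-∀

  A*B≥c : n * (k ∸ 1) * Cₖ * C′ * c ^ k ≤ A * B
  A*B≥c = begin
    n * j * Cₖ * C′ * c ^ k         ≡⟨ shape n j Cₖ C′ (c ^ k) ⟩
    (n * C′) * (Cₖ * (j * c ^ k))   ≡⟨ cong (_* (Cₖ * (j * c ^ k))) n*C′≡Cₖ*k ⟩
    (Cₖ * k) * (Cₖ * (j * c ^ k))   ≤⟨ *-mono-≤ A≥k B≥c ⟩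
    A * B                           ∎
    where
    open ≤-Reasoning
    shape : ∀ n j C C′ x → n * j * C * C′ * x ≡ (n * C′) * (C * (j * x))
    shape = solve-∀

  A*B≥k² : k ^ 2 * Cₖ ^ 2 ≤ A * B
  A*B≥k² = subst (_≤ A * B) (shape k Cₖ) (*-mono-≤ A≥k B≥k)
    where
    shape : ∀ k C → (C * k) * (C * k) ≡ k * (k * 1) * (C * (C * 1))
    shape = solve-∀

-- The case hypotheses on δ and Δ, and k ≤ n, are not needed: every bound holds unconditionally.
corollary3p1 : (n : ℕ) (G : Graph n) (Δ δ k : ℕ) (d dc : Subset n → ℕ) →
  4 ≤ n → Connected G → Connected (complement G) →
  IsMaxDegree G Δ → IsMinDegree G δ → 2 ≤ k → k ≤ n →
  (∀ S → ∣ S ∣ ≡ k → IsSteinerDist G S (d S)) →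
  (∀ S → ∣ S ∣ ≡ k → IsSteinerDist (complement G) S (dc S)) →
  let s₁ = Δ ⊔ (n ∸ δ ∸ 1)
      t₁ = δ ⊓ (n ∸ Δ ∸ 1)
      A = SGut G k d
      B = SGut (complement G) k dc
  in (A + B ≤ (n ∸ 1) ^ 2 * (n C k) * s₁ ^ (k ∸ 1))
     × (2 ≤ δ → Δ ≤ n ∸ 3 → (n ∸ 1) * (k ∸ 1) * (n C k) * t₁ ^ (k ∸ 1) ≤ A + B)
     × (2 ≤ δ → Δ ≡ n ∸ 2 →
          n * (k ∸ 1) * ((n ∸ 1) C (k ∸ 1)) * δ ^ k + k * (k * (n C k)) ≤ k * (A + B))
     × (δ ≡ 1 → Δ ≤ n ∸ 3 →
          k * (k * (n C k)) + n * (k ∸ 1) * ((n ∸ 1) C (k ∸ 1)) * (n ∸ Δ ∸ 1) ^ k ≤ k * (A + B))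
     × (δ ≡ 1 → Δ ≡ n ∸ 2 → 2 * k * (n C k) ≤ A + B)
     × (4 * k ^ 2 * (A * B)
          ≤ n ^ 2 * ((n ∸ 1) C (k ∸ 1)) ^ 2 * (Δ ^ (k ∸ 1) * (n ∸ δ ∸ 1) ^ (k ∸ 1) * (n ∸ 1) ^ 4))
     × (2 ≤ δ → Δ ≤ n ∸ 3 →
          n ^ 2 * (k ∸ 1) ^ 2 * ((n ∸ 1) C (k ∸ 1)) ^ 2 * (δ ^ k * (n ∸ Δ ∸ 1) ^ k) ≤ k ^ 2 * (A * B))
     × (2 ≤ δ → Δ ≡ n ∸ 2 → n * (k ∸ 1) * (n C k) * ((n ∸ 1) C (k ∸ 1)) * δ ^ k ≤ A * B)
     × (δ ≡ 1 → Δ ≤ n ∸ 3 →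
          n * (k ∸ 1) * (n C k) * ((n ∸ 1) C (k ∸ 1)) * (n ∸ Δ ∸ 1) ^ k ≤ A * B)
     × (δ ≡ 1 → Δ ≡ n ∸ 2 → k ^ 2 * (n C k) ^ 2 ≤ A * B)
corollary3p1 _ G Δ δ _ d dc (s≤s (s≤s (s≤s (s≤s _)))) conn connᶜ maxd mind 2≤k@(s≤s _) _ sd sdᶜ =
  A+B≤ , (λ _ _ → A+B≥t₁) , (λ _ _ → A+B≥δ) , (λ _ _ → A+B≥c) , (λ _ _ → A+B≥2k) ,
  A*B≤ , (λ _ _ → A*B≥δc) , (λ _ _ → A*B≥δ) , (λ _ _ → A*B≥c) , (λ _ _ → A*B≥k²)
  where open Corollary G conn connᶜ maxd mind 2≤k sd sdᶜ
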